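{- Let $q$ be a prime power, $\mathrm{PG}(3,q)=\mathrm{AG}(3,q)\cup H_\infty$, and let $U\subset\mathrm{AG}(3,q)$ with $|U|=q^2$, $U$ not contained in a plane. Let $\ell_1,\ell_2$ be two distinct lines of $H_\infty$ not determined by $U$, and let $M=\ell_1\cap\ell_2$. (Then $U$ is the union of $q$ affine lines, one in each affine plane through $\ell_1$.) If two of these $q$ lines are not parallel, then the $q$ lines have $q$ pairwise distinct ideal points, none of which is $M$.
   Context: A line $\ell\subset H_\infty$ is determined by $U$ if some affine plane whose line at infinity is $\ell$ contains three non-collinear points of $U$. Since $|U|=q^2$, if $\ell$ is not determined then each of the $q$ affine planes through $\ell$ meets $U$ in exactly one complete affine line. The ideal point of an affine line is its point at infinity. -}

module Defs where

open import Data.Nat using (ℕ)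
open import Data.Fin using (Fin)
open import Data.Product using (Σ; ∃; _×_; _,_)
open import Data.List using (List; length)
open import Data.List.Membership.Propositional using (_∈_)
open import Data.List.Relation.Unary.All using (All)
open import Data.List.Relation.Unary.Unique.Propositional using (Unique)
open import Relation.Nullary using (¬_)
open import Relation.Binary.PropositionalEquality using (_≡_; _≢_)
open import Algebra.Structures using (IsCommutativeRing)
open import Function.Bundles using (_↔_; _⇔_)

-- A finite field with exactly q elements (so q is a prime power, GF(q)).
record FiniteField (q : ℕ) : Set₁ where
  infixl 6 _+_
  infixl 7 _*_
  field
    Carrier : Set
    _+_ _*_ : Carrier → Carrier → Carrier
    -_      : Carrier → Carrier
    0# 1#   : Carrier
    isCommutativeRing : IsCommutativeRing _≡_ _+_ _*_ -_ 0# 1#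
    0≢1     : 0# ≢ 1#
    inverse : ∀ x → x ≢ 0# → Σ Carrier λ y → x * y ≡ 1#
    enum    : Carrier ↔ Fin q

module Geometry {q : ℕ} (F : FiniteField q) where
  open FiniteField F

  Point : Set
  Point = Carrier × Carrier × Carrier

  _⊕_ : Point → Point → Point
  (x₁ , y₁ , z₁) ⊕ (x₂ , y₂ , z₂) = (x₁ + x₂ , y₁ + y₂ , z₁ + z₂)

  _•_ : Carrier → Point → Point
  k • (x , y , z) = (k * x , k * y , k * z)

  _·_ : Point → Point → Carrier
  (x₁ , y₁ , z₁) · (x₂ , y₂ , z₂) = x₁ * x₂ + y₁ * y₂ + z₁ * z₂

  𝟎 : Point
  𝟎 = (0# , 0# , 0#)

  -- A point of H∞ is the class of a nonzero vector d (a direction);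
  -- a line of H∞ is given by a nonzero normal vector a: it consists of
  -- the directions d with a · d ≡ 0#.
  SameDirection : Point → Point → Set
  SameDirection d d' = ∃ λ k → d' ≡ k • d

  OnLineAtInfinity : Point → Point → Set
  OnLineAtInfinity a d = a · d ≡ 0#

  -- two lines of H∞ (given by nonzero normals) are equal iff normals are proportional
  DistinctLinesAtInfinity : Point → Point → Set
  DistinctLinesAtInfinity a₁ a₂ = ¬ SameDirection a₁ a₂

  -- affine plane {x | a · x = c} ; its line at infinity is the one with normal a
  OnPlane : Point → Carrier → Point → Set
  OnPlane a c x = a · x ≡ c

  record AffineLine : Set where
    constructor line
    field
      base : Point
      dir  : Point
      dir≢𝟎 : dir ≢ 𝟎

  OnLine : AffineLine → Point → Set
  OnLine L x = ∃ λ t → x ≡ AffineLine.base L ⊕ (t • AffineLine.dir L)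

  Parallel : AffineLine → AffineLine → Set
  Parallel L L' = SameDirection (AffineLine.dir L) (AffineLine.dir L')

  IdealPointOn : Point → AffineLine → Set
  IdealPointOn a L = OnLineAtInfinity a (AffineLine.dir L)

  Collinear : Point → Point → Point → Set
  Collinear u v w = ∃ λ L → OnLine L u × OnLine L v × OnLine L w

  ContainedInPlane : List Point → Set
  ContainedInPlane U = ∃ λ a → a ≢ 𝟎 × ∃ λ c → All (OnPlane a c) U

  Determined : List Point → Point → Set
  Determined U a = ∃ λ c → ∃ λ u → ∃ λ v → ∃ λ w →
    (u ∈ U × v ∈ U × w ∈ U) ×
    (OnPlane a c u × OnPlane a c v × OnPlane a c w) ×
    ¬ Collinear u v w

  SectionLine : List Point → Point → Carrier → AffineLine → Set
  SectionLine U a c L = ∀ x → ((x ∈ U × OnPlane a c x) ⇔ OnLine L x)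

module Submission where

-- Write ℓᵢ = {d | aᵢ · d = 0} and call a "section line" an affine
-- line L with U ∩ {a₁ · x = c} = L.  The only geometric input is that ℓ₂ is not
-- determined: points of U on one plane through ℓ₂ are collinear, so any plane
-- through two distinct such points contains the third (undetermined-coplanar).
--   (1) If one section line L had ideal point M, i.e. a₂ · dir L = 0, then
--       every section line Lg would too: otherwise Lg meets the plane through ℓ₂
--       containing L in a point X of U, which must lie on L, and then Lg ⊆ L.
--       All section directions would then be orthogonal to a₁ and a₂, hence
--       proportional, contradicting the two non-parallel section lines.
--   (2) If two section lines at distinct levels were parallel, they span a
--       plane π; by (1) both are transversal to the planes through ℓ₂, and each
--       point x of U is collinear with the two points where the plane through
--       ℓ₂ and x meets them, so U ⊆ π, contradicting that U spans AG(3,q).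

open import Defs
open import Data.Nat using (ℕ) renaming (_*_ to _*ℕ_)
open import Data.Product using (∃; _×_)
open import Data.List using (List; length)
open import Data.List.Relation.Unary.Unique.Propositional using (Unique)
open import Relation.Nullary using (¬_)
open import Relation.Binary.PropositionalEquality using (_≡_; _≢_)

open import Algebra.Bundles using (CommutativeRing)
open import Data.Nat as ℕ using (zero; suc)
import Data.Nat.Properties as ℕ
open import Data.Integer as ℤ using (ℤ; -[1+_])
import Data.Integer.Properties as ℤ
import Data.Fin.Properties as Fin
import Data.Sign as Sign
open import Data.Maybe using (Maybe; just; nothing)
open import Data.Product using (_,_; proj₁; proj₂)
open import Data.Empty using (⊥-elim)
open import Data.List.Membership.Propositional using (_∈_)
open import Data.List.Relation.Unary.All using (tabulate)
open import Function.Bundles using (Equivalence)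
open import Function.Properties.Inverse using (↔⇒↣)
open import Relation.Nullary using (yes; no)
open import Relation.Nullary.Decidable using (via-injection; decidable-stable)
open import Relation.Binary.Definitions using (DecidableEquality)
import Relation.Binary.PropositionalEquality as ≡

-- A ring solver for any commutative ring, with integer coefficients: the
-- canonical map ℤ → R is a ring morphism, and integer equality decides
-- coefficient equality, which is what the normaliser needs.
module IntegerCoefficients {c ℓ} (R : CommutativeRing c ℓ) where
  open CommutativeRing R
  open import Algebra.Properties.Semiring.Mult.TCOptimised semiring using (1+×; ×-homo-+; ×1-homo-*)
    renaming (_×_ to _×ₙ_)
  open import Algebra.Properties.Ring ring using (-‿involutive; -0#≈0#; -‿distribˡ-*; -‿distribʳ-*)
  open import Algebra.Properties.AbelianGroup +-abelianGroup using (⁻¹-∙-comm)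
  open import Algebra.Solver.Ring.AlmostCommutativeRing using (_-Raw-AlmostCommutative⟶_; fromCommutativeRing)
  open import Relation.Binary.Reasoning.Setoid setoid

  ⟦_⟧ : ℤ → Carrier
  ⟦ ℤ.+ n ⟧ = n ×ₙ 1#
  ⟦ -[1+ n ] ⟧ = - (suc n ×ₙ 1#)

  private
    cancel-common : ∀ x a b → (x + a) + - (x + b) ≈ a + - b
    cancel-common x a b = begin
      (x + a) + - (x + b)    ≈⟨ +-cong (+-comm x a) (sym (⁻¹-∙-comm x b)) ⟩
      (a + x) + (- x + - b)  ≈⟨ +-assoc a x _ ⟩
      a + (x + (- x + - b))  ≈⟨ +-congˡ (sym (+-assoc x (- x) (- b))) ⟩
      a + ((x + - x) + - b)  ≈⟨ +-congˡ (+-congʳ (-‿inverseʳ x)) ⟩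
      a + (0# + - b)         ≈⟨ +-congˡ (+-identityˡ (- b)) ⟩
      a + - b                ∎

  ⊖-homo : ∀ m n → ⟦ m ℤ.⊖ n ⟧ ≈ m ×ₙ 1# + - (n ×ₙ 1#)
  ⊖-homo zero    zero    = sym (trans (+-congˡ -0#≈0#) (+-identityʳ 0#))
  ⊖-homo zero    (suc n) = sym (+-identityˡ _)
  ⊖-homo (suc m) zero    = sym (trans (+-congˡ -0#≈0#) (+-identityʳ _))
  ⊖-homo (suc m) (suc n) = begin
    ⟦ suc m ℤ.⊖ suc n ⟧                  ≡⟨ ≡.cong ⟦_⟧ (ℤ.[1+m]⊖[1+n]≡m⊖n m n) ⟩
    ⟦ m ℤ.⊖ n ⟧                          ≈⟨ ⊖-homo m n ⟩
    m ×ₙ 1# + - (n ×ₙ 1#)                ≈⟨ cancel-common 1# _ _ ⟨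
    (1# + m ×ₙ 1#) + - (1# + n ×ₙ 1#)    ≈⟨ +-cong (1+× m 1#) (-‿cong (1+× n 1#)) ⟨
    suc m ×ₙ 1# + - (suc n ×ₙ 1#)        ∎

  +-homo : ∀ i j → ⟦ i ℤ.+ j ⟧ ≈ ⟦ i ⟧ + ⟦ j ⟧
  +-homo -[1+ m ] -[1+ n ] = begin
    - (suc (suc (m ℕ.+ n)) ×ₙ 1#)        ≡⟨ ≡.cong (λ k → - (suc k ×ₙ 1#)) (ℕ.+-suc m n) ⟨
    - ((suc m ℕ.+ suc n) ×ₙ 1#)          ≈⟨ -‿cong (×-homo-+ 1# (suc m) (suc n)) ⟩
    - (suc m ×ₙ 1# + suc n ×ₙ 1#)        ≈⟨ ⁻¹-∙-comm _ _ ⟨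
    - (suc m ×ₙ 1#) + - (suc n ×ₙ 1#)    ∎
  +-homo -[1+ m ] (ℤ.+ n)  = trans (⊖-homo n (suc m)) (+-comm _ _)
  +-homo (ℤ.+ m)  -[1+ n ] = ⊖-homo m (suc n)
  +-homo (ℤ.+ m)  (ℤ.+ n)  = ×-homo-+ 1# m n

  -‿homo : ∀ i → ⟦ ℤ.- i ⟧ ≈ - ⟦ i ⟧
  -‿homo -[1+ n ]     = sym (-‿involutive _)
  -‿homo (ℤ.+ zero)    = sym -0#≈0#
  -‿homo (ℤ.+ (suc n)) = refl

  -- multiplication is handled through the sign/magnitude decomposition
  private
    signed : Sign.Sign → Carrier → Carrier
    signed Sign.+ x = x
    signed Sign.- x = - x

    signed-cong : ∀ s {x y} → x ≈ y → signed s x ≈ signed s y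
    signed-cong Sign.+ x≈y = x≈y
    signed-cong Sign.- x≈y = -‿cong x≈y

    signed-* : ∀ s t x y → signed (s Sign.* t) (x * y) ≈ signed s x * signed t y
    signed-* Sign.- Sign.- x y = trans (sym (-‿involutive _)) (trans (-‿cong (-‿distribˡ-* x y)) (-‿distribʳ-* (- x) y))
    signed-* Sign.- Sign.+ x y = -‿distribˡ-* x y
    signed-* Sign.+ Sign.- x y = -‿distribʳ-* x y
    signed-* Sign.+ Sign.+ x y = refl

    ◃-homo : ∀ s n → ⟦ s ℤ.◃ n ⟧ ≈ signed s (n ×ₙ 1#)
    ◃-homo Sign.- zero    = sym -0#≈0#
    ◃-homo Sign.+ zero    = refl
    ◃-homo Sign.- (suc n) = refl
    ◃-homo Sign.+ (suc n) = refl

    sign-abs : ∀ i → ⟦ i ⟧ ≡.≡ signed (ℤ.sign i) (ℤ.∣ i ∣ ×ₙ 1#)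
    sign-abs (ℤ.+ n)  = ≡.refl
    sign-abs -[1+ n ] = ≡.refl

  *-homo : ∀ i j → ⟦ i ℤ.* j ⟧ ≈ ⟦ i ⟧ * ⟦ j ⟧
  *-homo i j = begin
    ⟦ (s Sign.* t) ℤ.◃ (ℤ.∣ i ∣ ℕ.* ℤ.∣ j ∣) ⟧               ≈⟨ ◃-homo (s Sign.* t) (ℤ.∣ i ∣ ℕ.* ℤ.∣ j ∣) ⟩
    signed (s Sign.* t) ((ℤ.∣ i ∣ ℕ.* ℤ.∣ j ∣) ×ₙ 1#)        ≈⟨ signed-cong (s Sign.* t) (×1-homo-* ℤ.∣ i ∣ ℤ.∣ j ∣) ⟩
    signed (s Sign.* t) ((ℤ.∣ i ∣ ×ₙ 1#) * (ℤ.∣ j ∣ ×ₙ 1#))  ≈⟨ signed-* s t _ _ ⟩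
    signed s (ℤ.∣ i ∣ ×ₙ 1#) * signed t (ℤ.∣ j ∣ ×ₙ 1#)      ≡⟨ ≡.cong₂ _*_ (sign-abs i) (sign-abs j) ⟨
    ⟦ i ⟧ * ⟦ j ⟧                                            ∎
    where
      s t : Sign.Sign
      s = ℤ.sign i
      t = ℤ.sign j

  morphism : ℤ.+-*-rawRing -Raw-AlmostCommutative⟶ fromCommutativeRing R
  morphism = record
    { ⟦_⟧ = ⟦_⟧ ; +-homo = +-homo ; *-homo = *-homo ; -‿homo = -‿homo
    ; 0-homo = refl ; 1-homo = refl }

  coefficient? : ∀ i j → Maybe (⟦ i ⟧ ≈ ⟦ j ⟧)
  coefficient? i j with i ℤ.≟ j
  ... | yes ≡.refl = just refl
  ... | no _       = nothing

  open import Algebra.Solver.Ring ℤ.+-*-rawRing (fromCommutativeRing R) morphism coefficient? public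
    using (solve; _:=_; _:+_; _:*_; :-_; con)

module FieldFacts {q : ℕ} (F : FiniteField q) where
  open FiniteField F
  open ≡ using (refl; sym; trans; cong)
  open ≡.≡-Reasoning

  commutativeRing : CommutativeRing _ _
  commutativeRing = record { isCommutativeRing = isCommutativeRing }

  open CommutativeRing commutativeRing using (*-assoc; *-identityʳ; +-group; ring)
  open import Algebra.Properties.Group +-group using (∙-cancelˡ; x∙y⁻¹≈ε⇒x≈y)
  open import Algebra.Properties.Ring ring using (-1*x≈-x)
  open IntegerCoefficients commutativeRing public using (solve; _:=_; _:+_; _:*_; :-_; con)

  infix 4 _≟_
  _≟_ : DecidableEquality Carrier
  _≟_ = via-injection (↔⇒↣ enum) Fin._≟_

  *-cancelʳ : ∀ {s s' f} → f ≢ 0# → s * f ≡ s' * f → s ≡ s'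
  *-cancelʳ {s} {s'} {f} f≢0 sf≡s'f with inverse f f≢0
  ... | f⁻¹ , ff⁻¹≡1 = begin
    s              ≡⟨ sym (*-identityʳ s) ⟩
    s * 1#         ≡⟨ cong (s *_) ff⁻¹≡1 ⟨
    s * (f * f⁻¹)  ≡⟨ *-assoc s f f⁻¹ ⟨
    s * f * f⁻¹    ≡⟨ cong (_* f⁻¹) sf≡s'f ⟩
    s' * f * f⁻¹   ≡⟨ *-assoc s' f f⁻¹ ⟩
    s' * (f * f⁻¹) ≡⟨ cong (s' *_) ff⁻¹≡1 ⟩
    s' * 1#        ≡⟨ *-identityʳ s' ⟩
    s'             ∎

  affine-injective : ∀ {p s s' f} → p + s * f ≡ p + s' * f → s ≢ s' → f ≡ 0#
  affine-injective {p} {s} {s'} {f} eq s≢s' with f ≟ 0#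
  ... | yes f≡0 = f≡0
  ... | no f≢0  = ⊥-elim (s≢s' (*-cancelʳ f≢0 (∙-cancelˡ p (s * f) (s' * f) eq)))

  difference≡0 : ∀ {x y} → x + - y ≡ 0# → x ≡ y
  difference≡0 {x} {y} = x∙y⁻¹≈ε⇒x≈y x y

  scaled-difference≡0 : ∀ {x y} → x + (- 1#) * y ≡ 0# → x ≡ y
  scaled-difference≡0 {x} {y} eq = difference≡0 (trans (cong (x +_) (sym (-1*x≈-x y))) eq)

module Vectors {q : ℕ} (F : FiniteField q) where
  open FiniteField F
  open Geometry F
  open FieldFacts F
  open ≡ using (refl; sym; trans; cong; cong₂)
  open ≡.≡-Reasoning

  vec≡ : ∀ {x₁ x₂ x₃ y₁ y₂ y₃} → x₁ ≡ y₁ → x₂ ≡ y₂ → x₃ ≡ y₃ →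
         _≡_ {A = Point} (x₁ , x₂ , x₃) (y₁ , y₂ , y₃)
  vec≡ refl refl refl = refl

  ·-affine : ∀ a p t f → a · (p ⊕ (t • f)) ≡ a · p + t * (a · f)
  ·-affine (a₁ , a₂ , a₃) (p₁ , p₂ , p₃) t (f₁ , f₂ , f₃) =
    solve 10 (λ a₁ a₂ a₃ p₁ p₂ p₃ t f₁ f₂ f₃ →
      a₁ :* (p₁ :+ t :* f₁) :+ a₂ :* (p₂ :+ t :* f₂) :+ a₃ :* (p₃ :+ t :* f₃)
      := (a₁ :* p₁ :+ a₂ :* p₂ :+ a₃ :* p₃) :+ t :* (a₁ :* f₁ :+ a₂ :* f₂ :+ a₃ :* f₃))
      refl a₁ a₂ a₃ p₁ p₂ p₃ t f₁ f₂ f₃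

  ·-scale : ∀ a k v → a · (k • v) ≡ k * (a · v)
  ·-scale (a₁ , a₂ , a₃) k (v₁ , v₂ , v₃) =
    solve 7 (λ a₁ a₂ a₃ k v₁ v₂ v₃ →
      a₁ :* (k :* v₁) :+ a₂ :* (k :* v₂) :+ a₃ :* (k :* v₃)
      := k :* (a₁ :* v₁ :+ a₂ :* v₂ :+ a₃ :* v₃))
      refl a₁ a₂ a₃ k v₁ v₂ v₃

  ·-orthogonal-scale : ∀ a k v → a · v ≡ 0# → a · (k • v) ≡ 0#
  ·-orthogonal-scale a k v a⊥v = begin
    a · (k • v) ≡⟨ ·-scale a k v ⟩
    k * (a · v) ≡⟨ cong (k *_) a⊥v ⟩
    k * 0#      ≡⟨ solve 1 (λ k → k :* con (ℤ.+ 0) := con (ℤ.+ 0)) refl k ⟩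
    0#          ∎

  _−_ : Point → Point → Point
  u − v = u ⊕ ((- 1#) • v)

  ·-difference≡0 : ∀ a u v → a · (u − v) ≡ 0# → a · u ≡ a · v
  ·-difference≡0 a u v a⊥u−v = scaled-difference≡0 (trans (sym (·-affine a u (- 1#) v)) a⊥u−v)

  _⨯_ : Point → Point → Point
  (v₁ , v₂ , v₃) ⨯ (w₁ , w₂ , w₃) =
    (v₂ * w₃ + - (v₃ * w₂) , v₃ * w₁ + - (v₁ * w₃) , v₁ * w₂ + - (v₂ * w₁))

  ⨯-orthogonalˡ : ∀ v w → (v ⨯ w) · v ≡ 0#
  ⨯-orthogonalˡ (v₁ , v₂ , v₃) (w₁ , w₂ , w₃) = solve 6 (λ v₁ v₂ v₃ w₁ w₂ w₃ →
    (v₂ :* w₃ :+ :- (v₃ :* w₂)) :* v₁ :+ (v₃ :* w₁ :+ :- (v₁ :* w₃)) :* v₂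
      :+ (v₁ :* w₂ :+ :- (v₂ :* w₁)) :* v₃
    := con (ℤ.+ 0)) refl v₁ v₂ v₃ w₁ w₂ w₃

  ⨯-orthogonalʳ : ∀ v w → (v ⨯ w) · w ≡ 0#
  ⨯-orthogonalʳ (v₁ , v₂ , v₃) (w₁ , w₂ , w₃) = solve 6 (λ v₁ v₂ v₃ w₁ w₂ w₃ →
    (v₂ :* w₃ :+ :- (v₃ :* w₂)) :* w₁ :+ (v₃ :* w₁ :+ :- (v₁ :* w₃)) :* w₂
      :+ (v₁ :* w₂ :+ :- (v₂ :* w₁)) :* w₃
    := con (ℤ.+ 0)) refl v₁ v₂ v₃ w₁ w₂ w₃

  ⨯-⨯-expansion : ∀ a b d → (a ⨯ b) ⨯ d ≡ ((a · d) • b) ⊕ ((- (b · d)) • a)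
  ⨯-⨯-expansion (a₁ , a₂ , a₃) (b₁ , b₂ , b₃) (d₁ , d₂ , d₃) = vec≡
    (solve 9 (λ a₁ a₂ a₃ b₁ b₂ b₃ d₁ d₂ d₃ →
      (a₃ :* b₁ :+ :- (a₁ :* b₃)) :* d₃ :+ :- ((a₁ :* b₂ :+ :- (a₂ :* b₁)) :* d₂)
      := (a₁ :* d₁ :+ a₂ :* d₂ :+ a₃ :* d₃) :* b₁ :+ :- (b₁ :* d₁ :+ b₂ :* d₂ :+ b₃ :* d₃) :* a₁)
      refl a₁ a₂ a₃ b₁ b₂ b₃ d₁ d₂ d₃)
    (solve 9 (λ a₁ a₂ a₃ b₁ b₂ b₃ d₁ d₂ d₃ →
      (a₁ :* b₂ :+ :- (a₂ :* b₁)) :* d₁ :+ :- ((a₂ :* b₃ :+ :- (a₃ :* b₂)) :* d₃)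
      := (a₁ :* d₁ :+ a₂ :* d₂ :+ a₃ :* d₃) :* b₂ :+ :- (b₁ :* d₁ :+ b₂ :* d₂ :+ b₃ :* d₃) :* a₂)
      refl a₁ a₂ a₃ b₁ b₂ b₃ d₁ d₂ d₃)
    (solve 9 (λ a₁ a₂ a₃ b₁ b₂ b₃ d₁ d₂ d₃ →
      (a₂ :* b₃ :+ :- (a₃ :* b₂)) :* d₂ :+ :- ((a₃ :* b₁ :+ :- (a₁ :* b₃)) :* d₁)
      := (a₁ :* d₁ :+ a₂ :* d₂ :+ a₃ :* d₃) :* b₃ :+ :- (b₁ :* d₁ :+ b₂ :* d₂ :+ b₃ :* d₃) :* a₃)
      refl a₁ a₂ a₃ b₁ b₂ b₃ d₁ d₂ d₃)

  ⨯-⨯-orthogonal : ∀ a b d → a · d ≡ 0# → b · d ≡ 0# → (a ⨯ b) ⨯ d ≡ 𝟎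
  ⨯-⨯-orthogonal a b d a⊥d b⊥d = begin
    (a ⨯ b) ⨯ d                           ≡⟨ ⨯-⨯-expansion a b d ⟩
    ((a · d) • b) ⊕ ((- (b · d)) • a)     ≡⟨ cong₂ (λ x y → (x • b) ⊕ ((- y) • a)) a⊥d b⊥d ⟩
    (0# • b) ⊕ ((- 0#) • a)               ≡⟨ vanish b a ⟩
    𝟎                                     ∎
    where
      vanish : ∀ u v → (0# • u) ⊕ ((- 0#) • v) ≡ 𝟎
      vanish (u₁ , u₂ , u₃) (v₁ , v₂ , v₃) = vec≡ (zero-sum u₁ v₁) (zero-sum u₂ v₂) (zero-sum u₃ v₃)
        where
          zero-sum : ∀ x y → 0# * x + (- 0#) * y ≡ 0#
          zero-sum = solve 2 (λ x y → con (ℤ.+ 0) :* x :+ (:- con (ℤ.+ 0)) :* y := con (ℤ.+ 0)) refl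

  ⨯-scaled-self : ∀ k k' n → (k • n) ⨯ (k' • n) ≡ 𝟎
  ⨯-scaled-self k k' (n₁ , n₂ , n₃) = vec≡ (cancel n₂ n₃) (cancel n₃ n₁) (cancel n₁ n₂)
    where
      cancel : ∀ x y → (k * x) * (k' * y) + - ((k * y) * (k' * x)) ≡ 0#
      cancel x y = solve 4 (λ k k' x y →
        (k :* x) :* (k' :* y) :+ :- ((k :* y) :* (k' :* x)) := con (ℤ.+ 0)) refl k k' x y

  proportional-coordinate : ∀ {v₁ i wⱼ vⱼ w₁} → v₁ * i ≡ 1# → v₁ * wⱼ ≡ vⱼ * w₁ → wⱼ ≡ (w₁ * i) * vⱼ
  proportional-coordinate {v₁} {i} {wⱼ} {vⱼ} {w₁} v₁i≡1 eq = begin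
    wⱼ              ≡⟨ solve 1 (λ w → w := w :* con (ℤ.+ 1)) refl wⱼ ⟩
    wⱼ * 1#         ≡⟨ cong (wⱼ *_) v₁i≡1 ⟨
    wⱼ * (v₁ * i)   ≡⟨ solve 3 (λ w v i → w :* (v :* i) := (v :* w) :* i) refl wⱼ v₁ i ⟩
    (v₁ * wⱼ) * i   ≡⟨ cong (_* i) eq ⟩
    (vⱼ * w₁) * i   ≡⟨ solve 3 (λ v w i → (v :* w) :* i := (w :* i) :* v) refl vⱼ w₁ i ⟩
    (w₁ * i) * vⱼ   ∎

  vanishing-minors⇒proportional : ∀ {v₁ v₂ v₃ w₁ w₂ w₃} → _≢_ {A = Point} (v₁ , v₂ , v₃) 𝟎 →
    v₂ * w₃ ≡ v₃ * w₂ → v₃ * w₁ ≡ v₁ * w₃ → v₁ * w₂ ≡ v₂ * w₁ →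
    SameDirection (v₁ , v₂ , v₃) (w₁ , w₂ , w₃)
  vanishing-minors⇒proportional {v₁} {v₂} {v₃} {w₁} {w₂} {w₃} v≢𝟎 m₁ m₂ m₃
    with v₁ ≟ 0# | v₂ ≟ 0# | v₃ ≟ 0#
  ... | no v₁≢0 | _ | _ = let (i , v₁i≡1) = inverse v₁ v₁≢0 in w₁ * i ,
    vec≡ (proportional-coordinate v₁i≡1 refl) (proportional-coordinate v₁i≡1 m₃)
         (proportional-coordinate v₁i≡1 (sym m₂))
  ... | yes _ | no v₂≢0 | _ = let (i , v₂i≡1) = inverse v₂ v₂≢0 in w₂ * i ,
    vec≡ (proportional-coordinate v₂i≡1 (sym m₃)) (proportional-coordinate v₂i≡1 refl)
         (proportional-coordinate v₂i≡1 m₁)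
  ... | yes _ | yes _ | no v₃≢0 = let (i , v₃i≡1) = inverse v₃ v₃≢0 in w₃ * i ,
    vec≡ (proportional-coordinate v₃i≡1 m₂) (proportional-coordinate v₃i≡1 (sym m₁))
         (proportional-coordinate v₃i≡1 refl)
  ... | yes v₁≡0 | yes v₂≡0 | yes v₃≡0 = ⊥-elim (v≢𝟎 (vec≡ v₁≡0 v₂≡0 v₃≡0))

  ⨯≡𝟎⇒proportional : ∀ v w → v ≢ 𝟎 → v ⨯ w ≡ 𝟎 → SameDirection v w
  ⨯≡𝟎⇒proportional (v₁ , v₂ , v₃) (w₁ , w₂ , w₃) v≢𝟎 v⨯w≡𝟎 = vanishing-minors⇒proportional v≢𝟎
    (difference≡0 (cong proj₁ v⨯w≡𝟎))
    (difference≡0 (cong (λ u → proj₁ (proj₂ u)) v⨯w≡𝟎))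
    (difference≡0 (cong (λ u → proj₂ (proj₂ u)) v⨯w≡𝟎))

  -- two vectors orthogonal to two independent normals a₁, a₂ are proportional:
  -- both are multiples of a₁ × a₂ (the intersection of two planes through 0 is a line)
  common-orthogonal⇒proportional : ∀ {a₁ a₂} d d' → a₁ ≢ 𝟎 → ¬ SameDirection a₁ a₂ → d ≢ 𝟎 →
    a₁ · d ≡ 0# → a₂ · d ≡ 0# → a₁ · d' ≡ 0# → a₂ · d' ≡ 0# → SameDirection d d'
  common-orthogonal⇒proportional {a₁} {a₂} d d' a₁≢𝟎 a₁∦a₂ d≢𝟎 a₁⊥d a₂⊥d a₁⊥d' a₂⊥d' =
    ⨯≡𝟎⇒proportional d d' d≢𝟎 (begin
      d ⨯ d'             ≡⟨ cong₂ _⨯_ (proj₂ d∥n) (proj₂ d'∥n) ⟩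
      (k • n) ⨯ (k' • n) ≡⟨ ⨯-scaled-self k k' n ⟩
      𝟎                  ∎)
    where
      n : Point
      n = a₁ ⨯ a₂
      n≢𝟎 : n ≢ 𝟎
      n≢𝟎 n≡𝟎 = a₁∦a₂ (⨯≡𝟎⇒proportional a₁ a₂ a₁≢𝟎 n≡𝟎)
      d∥n : SameDirection n d
      d∥n = ⨯≡𝟎⇒proportional n d n≢𝟎 (⨯-⨯-orthogonal a₁ a₂ d a₁⊥d a₂⊥d)
      d'∥n : SameDirection n d'
      d'∥n = ⨯≡𝟎⇒proportional n d' n≢𝟎 (⨯-⨯-orthogonal a₁ a₂ d' a₁⊥d' a₂⊥d')
      k k' : Carrier
      k = proj₁ d∥n
      k' = proj₁ d'∥n

module Lines {q : ℕ} (F : FiniteField q) where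
  open FiniteField F
  open Geometry F
  open FieldFacts F
  open Vectors F
  open AffineLine
  open ≡ using (refl; sym; trans; cong)
  open ≡.≡-Reasoning

  at : AffineLine → Carrier → Point
  at L t = base L ⊕ (t • dir L)

  constant-along : ∀ a p f t → a · f ≡ 0# → a · (p ⊕ (t • f)) ≡ a · p
  constant-along a p f t a⊥f = begin
    a · (p ⊕ (t • f))  ≡⟨ ·-affine a p t f ⟩
    a · p + t * (a · f) ≡⟨ cong (λ x → a · p + t * x) a⊥f ⟩
    a · p + t * 0#      ≡⟨ solve 2 (λ x t → x :+ t :* con (ℤ.+ 0) := x) refl (a · p) t ⟩
    a · p               ∎

  equal-values⇒orthogonal : ∀ a p f {s s'} → a · (p ⊕ (s • f)) ≡ a · (p ⊕ (s' • f)) → s ≢ s' → a · f ≡ 0#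
  equal-values⇒orthogonal a p f {s} {s'} eq = affine-injective (begin
    a · p + s * (a · f)  ≡⟨ ·-affine a p s f ⟨
    a · (p ⊕ (s • f))    ≡⟨ eq ⟩
    a · (p ⊕ (s' • f))   ≡⟨ ·-affine a p s' f ⟩
    a · p + s' * (a · f) ∎)

  distinct-points : ∀ L → at L 0# ≢ at L 1#
  distinct-points L at₀≡at₁ = dir≢𝟎 L (vec≡
    (affine-injective (cong proj₁ at₀≡at₁) 0≢1)
    (affine-injective (cong (λ x → proj₁ (proj₂ x)) at₀≡at₁) 0≢1)
    (affine-injective (cong (λ x → proj₂ (proj₂ x)) at₀≡at₁) 0≢1))

  line-meets-plane : ∀ a L e → a · dir L ≢ 0# → ∃ λ t → a · at L t ≡ e
  line-meets-plane a L e a·f≢0 with inverse (a · dir L) a·f≢0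
  ... | i , yi≡1 = t , (begin
    a · at L t                ≡⟨ ·-affine a (base L) t (dir L) ⟩
    x + ((e + - x) * i) * y   ≡⟨ solve 4 (λ x e i y → x :+ ((e :+ :- x) :* i) :* y
                                                   := x :+ (e :+ :- x) :* (y :* i)) refl x e i y ⟩
    x + (e + - x) * (y * i)   ≡⟨ cong (λ z → x + (e + - x) * z) yi≡1 ⟩
    x + (e + - x) * 1#        ≡⟨ solve 2 (λ x e → x :+ (e :+ :- x) :* con (ℤ.+ 1) := e) refl x e ⟩
    e                         ∎)
    where
      x y t : Carrier
      x = a · base L
      y = a · dir L
      t = (e + - x) * i

  collinear-in-plane : ∀ {u v w} a c → Collinear u v w → u ≢ v → a · u ≡ c → a · v ≡ c → a · w ≡ c
  collinear-in-plane a c (N , (s , refl) , (s' , refl) , (s'' , refl)) u≢v a·u≡c a·v≡c = begin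
    a · at N s''  ≡⟨ constant-along a (base N) (dir N) s'' a⊥dir ⟩
    a · base N    ≡⟨ constant-along a (base N) (dir N) s a⊥dir ⟨
    a · at N s    ≡⟨ a·u≡c ⟩
    c             ∎
    where
      a⊥dir : a · dir N ≡ 0#
      a⊥dir = equal-values⇒orthogonal a (base N) (dir N) (trans a·u≡c (sym a·v≡c))
                (λ s≡s' → u≢v (cong (at N) s≡s'))

  CommonPlane : AffineLine → AffineLine → Set
  CommonPlane L L' = ∃ λ m → m ≢ 𝟎 × ∃ λ κ → (∀ t → m · at L t ≡ κ) × (∀ t → m · at L' t ≡ κ)

  -- two parallel lines whose base points differ by a vector not parallel to them
  -- span a plane, with normal dir L × (base L − base L')
  parallel-lines-coplanar : ∀ L L' → Parallel L L' → ¬ SameDirection (dir L) (base L − base L') →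
    CommonPlane L L'
  parallel-lines-coplanar L L' (k , d'≡kd) d∦w = m , m≢𝟎 , m · base L , on-L , on-L'
    where
      w m : Point
      w = base L − base L'
      m = dir L ⨯ w
      m≢𝟎 : m ≢ 𝟎
      m≢𝟎 m≡𝟎 = d∦w (⨯≡𝟎⇒proportional (dir L) w (dir≢𝟎 L) m≡𝟎)
      m⊥d : m · dir L ≡ 0#
      m⊥d = ⨯-orthogonalˡ (dir L) w
      m⊥d' : m · dir L' ≡ 0#
      m⊥d' = trans (cong (m ·_) d'≡kd) (·-orthogonal-scale m k (dir L) m⊥d)
      on-L : ∀ t → m · at L t ≡ m · base L
      on-L t = constant-along m (base L) (dir L) t m⊥d
      on-L' : ∀ t → m · at L' t ≡ m · base L
      on-L' t = trans (constant-along m (base L') (dir L') t m⊥d')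
                      (sym (·-difference≡0 m (base L) (base L') (⨯-orthogonalʳ (dir L) w)))

module Sections {q : ℕ} (F : FiniteField q) (U : List (Geometry.Point F)) where
  open FiniteField F
  open Geometry F
  open FieldFacts F
  open Vectors F
  open Lines F
  open AffineLine
  open ≡ using (refl; sym; trans; cong)
  open ≡.≡-Reasoning

  -- SectionLine packaged as a record, so that a, c and L are inferable from it
  record Section (a : Point) (c : Carrier) (L : AffineLine) : Set where
    constructor section
    field characterisation : SectionLine U a c L

  section-point : ∀ {a c L} → Section a c L → ∀ t → at L t ∈ U × a · at L t ≡ c
  section-point {L = L} (section S) t = Equivalence.from (S (at L t)) (t , refl)

  section-covers : ∀ {a c L x} → Section a c L → x ∈ U → a · x ≡ c → OnLine L x
  section-covers {x = x} (section S) x∈U a·x≡c = Equivalence.to (S x) (x∈U , a·x≡c)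

  section-direction : ∀ {a c L} → Section a c L → a · dir L ≡ 0#
  section-direction {a} {c} {L} S = equal-values⇒orthogonal a (base L) (dir L)
    (trans (proj₂ (section-point S 0#)) (sym (proj₂ (section-point S 1#)))) 0≢1

  section-base : ∀ {a c L} → Section a c L → a · base L ≡ c
  section-base {a} {c} {L} S =
    trans (sym (constant-along a (base L) (dir L) 0# (section-direction S))) (proj₂ (section-point S 0#))

  distinct-levels-apart : ∀ {a c c' L L'} → Section a c L → Section a c' L' → c ≢ c' →
    ¬ SameDirection (dir L) (base L − base L')
  distinct-levels-apart {a} {c} {c'} {L} {L'} S S' c≢c' (j , gap≡jd) = c≢c' (begin
    c           ≡⟨ section-base S ⟨
    a · base L  ≡⟨ ·-difference≡0 a (base L) (base L') a⊥gap ⟩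
    a · base L' ≡⟨ section-base S' ⟩
    c'          ∎)
    where
      a⊥gap : a · (base L − base L') ≡ 0#
      a⊥gap = trans (cong (a ·_) gap≡jd) (·-orthogonal-scale a j (dir L) (section-direction S))

  -- if the line at infinity of a is not determined by U, the points of U on a
  -- plane a · x = e are collinear: every plane through two distinct ones
  -- contains any third
  undetermined-coplanar : ∀ a m κ {e u v w} → ¬ Determined U a → u ∈ U → v ∈ U → w ∈ U →
    a · u ≡ e → a · v ≡ e → a · w ≡ e → u ≢ v → m · u ≡ κ → m · v ≡ κ → m · w ≡ κ
  undetermined-coplanar a m κ {e} {u} {v} {w} undetermined u∈U v∈U w∈U a·u a·v a·w u≢v m·u m·v =
    decidable-stable (m · w ≟ κ) λ m·w≢κ →
      undetermined (e , u , v , w , (u∈U , v∈U , w∈U) , (a·u , a·v , a·w) ,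
        λ collinear → m·w≢κ (collinear-in-plane m κ collinear u≢v m·u m·v))

module Steps {q : ℕ} (F : FiniteField q) (U : List (Geometry.Point F)) (a₁ a₂ : Geometry.Point F)
             (ℓ₂-undetermined : ¬ Geometry.Determined F U a₂) where
  open FiniteField F
  open Geometry F
  open FieldFacts F
  open Vectors F
  open Lines F
  open Sections F U
  open AffineLine
  open ≡ using (refl; sym; trans; cong)

  -- a section line L with ideal point M leaves no room for a section line Lg
  -- transversal to the planes through ℓ₂: the plane through ℓ₂ and L meets Lg in
  -- a point X of U, which must lie on L, so Lg is at the level of L and Lg ⊆ L
  no-transversal-beside-M : ∀ {c g L Lg} → Section a₁ c L → a₂ · dir L ≡ 0# →
    Section a₁ g Lg → ¬ (a₂ · dir Lg ≢ 0#)
  no-transversal-beside-M {c} {g} {L} {Lg} S L⊥a₂ Sg Lg-transversal = Lg-transversal Lg⊥a₂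
    where
      L-in-plane : ∀ s → a₂ · at L s ≡ a₂ · base L
      L-in-plane s = constant-along a₂ (base L) (dir L) s L⊥a₂
      X : ∃ λ t → a₂ · at Lg t ≡ a₂ · base L
      X = line-meets-plane a₂ Lg (a₂ · base L) Lg-transversal
      same-level : g ≡ c
      same-level = trans (sym (proj₂ (section-point Sg (proj₁ X))))
        (undetermined-coplanar a₂ a₁ c ℓ₂-undetermined
          (proj₁ (section-point S 0#)) (proj₁ (section-point S 1#)) (proj₁ (section-point Sg (proj₁ X)))
          (L-in-plane 0#) (L-in-plane 1#) (proj₂ X) (distinct-points L)
          (proj₂ (section-point S 0#)) (proj₂ (section-point S 1#)))
      Lg-in-plane : ∀ s → a₂ · at Lg s ≡ a₂ · base L
      Lg-in-plane s = trans (cong (a₂ ·_) (proj₂ on-L)) (L-in-plane (proj₁ on-L))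
        where
          on-L : OnLine L (at Lg s)
          on-L = section-covers S (proj₁ (section-point Sg s)) (trans (proj₂ (section-point Sg s)) same-level)
      Lg⊥a₂ : a₂ · dir Lg ≡ 0#
      Lg⊥a₂ = equal-values⇒orthogonal a₂ (base Lg) (dir Lg) (trans (Lg-in-plane 0#) (sym (Lg-in-plane 1#))) 0≢1

  M-spreads : ∀ {c g L Lg} → Section a₁ c L → a₂ · dir L ≡ 0# →
    Section a₁ g Lg → a₂ · dir Lg ≡ 0#
  M-spreads {Lg = Lg} S L⊥a₂ Sg = decidable-stable (a₂ · dir Lg ≟ 0#) (no-transversal-beside-M S L⊥a₂ Sg)

  NonParallelSections : Set
  NonParallelSections = ∃ λ c → ∃ λ c' → ∃ λ L → ∃ λ L' →
    SectionLine U a₁ c L × SectionLine U a₁ c' L' × ¬ Parallel L L'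

  -- Step (1): no section line has ideal point M, for otherwise all section
  -- directions would be orthogonal to both a₁ and a₂, hence proportional
  section-avoids-M : a₁ ≢ 𝟎 → DistinctLinesAtInfinity a₁ a₂ → NonParallelSections →
    ∀ {c L} → Section a₁ c L → a₂ · dir L ≢ 0#
  section-avoids-M a₁≢𝟎 ℓ₁≢ℓ₂ (g , g' , Lg , Lg' , Sg , Sg' , Lg∦Lg') S L⊥a₂ =
    Lg∦Lg' (common-orthogonal⇒proportional (dir Lg) (dir Lg') a₁≢𝟎 ℓ₁≢ℓ₂ (dir≢𝟎 Lg)
      (section-direction secg) (M-spreads S L⊥a₂ secg) (section-direction secg') (M-spreads S L⊥a₂ secg'))
    where
      secg : Section a₁ g Lg
      secg = section Sg
      secg' : Section a₁ g' Lg'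
      secg' = section Sg'

  -- Step (2): a plane containing two section lines at distinct levels, both
  -- transversal to the planes through ℓ₂, contains U; each x ∈ U is collinear
  -- with the points where the plane through ℓ₂ and x meets the two lines
  U-in-common-plane : ∀ {c c' L L'} → Section a₁ c L → Section a₁ c' L' → c ≢ c' →
    a₂ · dir L ≢ 0# → a₂ · dir L' ≢ 0# → CommonPlane L L' → ContainedInPlane U
  U-in-common-plane {c} {c'} {L} {L'} S S' c≢c' L-transversal L'-transversal (m , m≢𝟎 , κ , on-L , on-L') =
    m , m≢𝟎 , κ , tabulate in-plane
    where
      in-plane : ∀ {x} → x ∈ U → m · x ≡ κ
      in-plane {x} x∈U = undetermined-coplanar a₂ m κ ℓ₂-undetermined
          (proj₁ (section-point S t)) (proj₁ (section-point S' t')) x∈U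
          (proj₂ P) (proj₂ Q) refl P≢Q (on-L t) (on-L' t')
        where
          P : ∃ λ t → a₂ · at L t ≡ a₂ · x
          P = line-meets-plane a₂ L (a₂ · x) L-transversal
          Q : ∃ λ t' → a₂ · at L' t' ≡ a₂ · x
          Q = line-meets-plane a₂ L' (a₂ · x) L'-transversal
          t : Carrier
          t = proj₁ P
          t' : Carrier
          t' = proj₁ Q
          P≢Q : at L t ≢ at L' t'
          P≢Q P≡Q = c≢c' (trans (sym (proj₂ (section-point S t)))
                                (trans (cong (a₁ ·_) P≡Q) (proj₂ (section-point S' t'))))

  distinct-sections-not-parallel : a₁ ≢ 𝟎 → DistinctLinesAtInfinity a₁ a₂ → NonParallelSections →
    ¬ ContainedInPlane U → ∀ c c' L L' → c ≢ c' →
    SectionLine U a₁ c L → SectionLine U a₁ c' L' → ¬ Parallel L L'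
  distinct-sections-not-parallel a₁≢𝟎 ℓ₁≢ℓ₂ nonparallel U-spans c c' L L' c≢c' S S' L∥L' =
    U-spans (U-in-common-plane sec sec' c≢c'
      (section-avoids-M a₁≢𝟎 ℓ₁≢ℓ₂ nonparallel sec) (section-avoids-M a₁≢𝟎 ℓ₁≢ℓ₂ nonparallel sec')
      (parallel-lines-coplanar L L' L∥L' (distinct-levels-apart sec sec' c≢c')))
    where
      sec : Section a₁ c L
      sec = section S
      sec' : Section a₁ c' L'
      sec' = section S'

  ideal-point-not-M : a₁ ≢ 𝟎 → DistinctLinesAtInfinity a₁ a₂ → NonParallelSections →
    ∀ c L → SectionLine U a₁ c L → ¬ (IdealPointOn a₁ L × IdealPointOn a₂ L)
  ideal-point-not-M a₁≢𝟎 ℓ₁≢ℓ₂ nonparallel c L S (_ , L⊥a₂) =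
    section-avoids-M a₁≢𝟎 ℓ₁≢ℓ₂ nonparallel (section {a₁} {c} {L} S) L⊥a₂

-- The hypotheses |U| = q² and "ℓ₁ not determined" serve in the paper to show
-- that the sections through ℓ₁ are lines; here the section lines are given.
corollary4 : (q : ℕ) (F : FiniteField q) →
    let open FiniteField F
        open Geometry F
    in (U : List Point) → Unique U → length U ≡ q *ℕ q →
       ¬ ContainedInPlane U →
       (a₁ a₂ : Point) → a₁ ≢ 𝟎 → a₂ ≢ 𝟎 →
       DistinctLinesAtInfinity a₁ a₂ →
       ¬ Determined U a₁ → ¬ Determined U a₂ →
       (∃ λ c → ∃ λ c' → ∃ λ L → ∃ λ L' →
          SectionLine U a₁ c L × SectionLine U a₁ c' L' × ¬ Parallel L L') →
       (∀ c c' L L' → c ≢ c' →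
          SectionLine U a₁ c L → SectionLine U a₁ c' L' → ¬ Parallel L L')
       × (∀ c L → SectionLine U a₁ c L →
          ¬ (IdealPointOn a₁ L × IdealPointOn a₂ L))
corollary4 q F U _ _ U-spans a₁ a₂ a₁≢𝟎 _ ℓ₁≢ℓ₂ _ ℓ₂-undetermined nonparallel =
    distinct-sections-not-parallel a₁≢𝟎 ℓ₁≢ℓ₂ nonparallel U-spans
  , ideal-point-not-M a₁≢𝟎 ℓ₁≢ℓ₂ nonparallel
  where open Steps F U a₁ a₂ ℓ₂-undetermined
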